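{- Let $\alpha\in(0,1)$. There exist a set $A\subseteq \mathbb{N}$ with $d(A)=\alpha$ and a set $B\subseteq \mathbb{N}$ that meets every residue class in $\mathbb{N}$ such that $d(A+B)=d(A)$.
   Context: $d(C)=\lim_{N\to\infty}|C\cap\{1,\dots,N\}|/N$ (the natural density, required to exist). $A+B=\{a+b:a\in A,b\in B\}$. $B$ meets every residue class in $\mathbb{N}$ if $B\cap(a\mathbb{N}+b)\ne\emptyset$ for all $a,b\in\mathbb{N}$. -}

module Defs where

open import Data.Nat using (ℕ; zero; suc; _∸_; _≥_)
open import Data.Bool using (Bool; true; false; if_then_else_; _∧_)
open import Data.List using (upTo)
open import Data.Bool.ListAction using (any)
open import Data.Integer using (+_)
open import Data.Rational using (ℚ; _/_; _-_; _+_; ∣_∣; _≤_; _<_; 0ℚ; 1ℚ)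
open import Data.Product using (Σ; ∃; _×_)
open import Relation.Binary.PropositionalEquality using (_≡_)

-- Subsets of ℕ are represented by (decidable) characteristic functions.
-- The paper's ℕ is {1,2,3,...}; we use Agda's ℕ and require 0 ∉ S.
Subset : Set
Subset = ℕ → Bool

count : Subset → ℕ → ℕ
count C zero = zero
count C (suc n) = (if C (suc n) then suc (count C n) else count C n)

_⊕_ : Subset → Subset → Subset
(A ⊕ B) n = any (λ a → A a ∧ B (n ∸ a)) (upTo (suc n))

-- Real numbers à la Bishop: regular Cauchy sequences of rationals.
record ℝ : Set where
  field
    seq : ℕ → ℚ
    reg : ∀ m n → ∣ seq m - seq n ∣ ≤ (+ 1 / suc m) + (+ 1 / suc n)
open ℝ public

0<ℝ : ℝ → Set
0<ℝ x = ∃ λ n → (+ 1 / suc n) < seq x n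

ℝ<1 : ℝ → Set
ℝ<1 x = ∃ λ n → seq x n < 1ℚ - (+ 1 / suc n)

within : ℚ → ℚ → ℝ → Set
within ε q x = ∀ j → ∣ q - seq x j ∣ ≤ ε + (+ 1 / suc j)

HasDensity : Subset → ℝ → Set
HasDensity C α = ∀ k → Σ ℕ λ M → ∀ N → N ≥ M →
  within (+ 1 / suc k) (+ count C (suc N) / suc N) α

-- B ⊆ {1,2,...} meets every residue class aℕ + b = {a n + b : n ≥ 1}, a, b ≥ 1
MeetsEveryResidueClass : Subset → Set
MeetsEveryResidueClass B = ∀ a b → Σ ℕ λ n → B (suc a Data.Nat.* suc n Data.Nat.+ suc b) ≡ true

-- Approximate α by fractions e J / d J in [0, 1] (clamped terms of its Cauchy sequence) which move
-- by O(1 / J) from J to J + 1, and cut ℕ into rapidly growing blocks. On block J, A is periodic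
-- modulo P J with density e J / d J, and B consists of the J + 1 consecutive numbers s J, …, s J + J
-- with P J ∣ s J; so B meets every residue class. The elements of B before block J are smaller than
-- a window ρ J with (1 + J) ρ J ≤ P J, so a sum a + b in block J lies in A, in the window of width
-- ρ J following the pattern modulo P J, or (a earlier, b in block J) shortly after s J; both
-- exceptional sets have proportion O(1 / J). As each block dwarfs everything before it, the counting
-- functions of A and A + B up to any N in block J are within O(1 / J) of e J / d J.

module Submission where

open import Defs
open import Data.Bool using (false)
open import Data.Product using (Σ; _×_; _,_)
open import Relation.Binary.PropositionalEquality using (_≡_; refl)

module NatArithmetic where

  open import Data.Nat.Base
  open import Data.Nat.Properties
  open import Data.Nat.DivMod using (_%_; _/_; m≡m%n+[m/n]*n; m%n<n; m/n*n≤m)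
  open import Data.Product using (Σ; _×_; _,_)
  open import Data.Sum using (inj₁; inj₂)
  open import Relation.Binary.PropositionalEquality

  ∣m-n∣≤o : ∀ {m n o} → m ≤ n + o → n ≤ m + o → ∣ m - n ∣ ≤ o
  ∣m-n∣≤o {m} {n} m≤n+o n≤m+o with ∣m-n∣≡[m∸n]∨[n∸m] m n
  ... | inj₁ eq = subst (_≤ _) (sym eq) (m≤n+o⇒m∸n≤o m n m≤n+o)
  ... | inj₂ eq = subst (_≤ _) (sym eq) (m≤n+o⇒m∸n≤o n m n≤m+o)

  m,n≤o⇒∣m-n∣≤o : ∀ {m n o} → m ≤ o → n ≤ o → ∣ m - n ∣ ≤ o
  m,n≤o⇒∣m-n∣≤o {m} {n} m≤o n≤o = ≤-trans (∣m-n∣≤m⊔n m n) (⊔-lub m≤o n≤o)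

  ∣m+n-o+p∣≤∣m-o∣+∣n-p∣ : ∀ m n o p → ∣ m + n - o + p ∣ ≤ ∣ m - o ∣ + ∣ n - p ∣
  ∣m+n-o+p∣≤∣m-o∣+∣n-p∣ m n o p = begin
    ∣ m + n - o + p ∣                  ≤⟨ ∣-∣-triangle (m + n) (o + n) (o + p) ⟩
    ∣ m + n - o + n ∣ + ∣ o + n - o + p ∣ ≡⟨ cong₂ _+_ ∣m+n-o+n∣≡∣m-o∣ (∣m+n-m+o∣≡∣n-o∣ o n p) ⟩
    ∣ m - o ∣ + ∣ n - p ∣                ∎
    where
    open ≤-Reasoning
    ∣m+n-o+n∣≡∣m-o∣ : ∣ m + n - o + n ∣ ≡ ∣ m - o ∣
    ∣m+n-o+n∣≡∣m-o∣ = trans (cong₂ ∣_-_∣ (+-comm m n) (+-comm o n)) (∣m+n-m+o∣≡∣n-o∣ n m o)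

  multiple-in-window : ∀ z a → Σ ℕ λ n → z ≤ n * suc a × n * suc a ≤ z + a
  multiple-in-window z a = n , z≤nq , m/n*n≤m (z + a) (suc a)
    where
    n = (z + a) / suc a
    z≤nq : z ≤ n * suc a
    z≤nq = +-cancelʳ-≤ a z (n * suc a) (begin
      z + a                          ≡⟨ m≡m%n+[m/n]*n (z + a) (suc a) ⟩
      (z + a) % suc a + n * suc a    ≤⟨ +-monoˡ-≤ (n * suc a) (s≤s⁻¹ (m%n<n (z + a) (suc a))) ⟩
      a + n * suc a                  ≡⟨ +-comm a (n * suc a) ⟩
      n * suc a + a                  ∎)
      where open ≤-Reasoning

module Counting where

  open import Data.Bool.Base using (Bool; true; false; T; if_then_else_; _∨_; _∧_)
  open import Data.Bool.Properties using (T-∨)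
  open import Data.Empty using (⊥-elim)
  open import Data.Nat.Base
  open import Data.Nat.Properties
  open import Data.Nat.Tactic.RingSolver using (solve-∀)
  open import Data.Nat.DivMod using (_%_; _/_; m≡m%n+[m/n]*n; m%n<n)
  open import Data.Product using (_,_; _×_; proj₁; proj₂)
  open import Data.Sum using (_⊎_)
  open import Function using (_∘_; Equivalence)
  open import Relation.Nullary.Decidable using (yes; no; ⌊_⌋; fromWitness)
  open import Relation.Nullary.Negation using (contradiction)
  open import Relation.Binary.PropositionalEquality
  open NatArithmetic

  countBelow : (ℕ → Bool) → ℕ → ℕ
  countBelow f zero    = zero
  countBelow f (suc n) = if f n then suc (countBelow f n) else countBelow f n

  count≡countBelow : ∀ C n → count C n ≡ countBelow (C ∘ suc) n
  count≡countBelow C zero    = refl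
  count≡countBelow C (suc n) with C (suc n)
  ... | true  = cong suc (count≡countBelow C n)
  ... | false = count≡countBelow C n

  countBelow-≤ : ∀ f n → countBelow f n ≤ n
  countBelow-≤ f zero    = z≤n
  countBelow-≤ f (suc n) with f n
  ... | true  = s≤s (countBelow-≤ f n)
  ... | false = m≤n⇒m≤1+n (countBelow-≤ f n)

  module _ (f : ℕ → Bool) where

    countBelow-+ : ∀ m n → countBelow f (m + n) ≡ countBelow f m + countBelow (f ∘ (m +_)) n
    countBelow-+ m zero    rewrite +-identityʳ m = sym (+-identityʳ _)
    countBelow-+ m (suc n) rewrite +-suc m n with f (m + n)
    ... | true  = trans (cong suc (countBelow-+ m n)) (sym (+-suc _ _))
    ... | false = countBelow-+ m n

    countBelow-monoʳ-≤ : ∀ {m n} → m ≤ n → countBelow f m ≤ countBelow f n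
    countBelow-monoʳ-≤ {m} {n} m≤n = begin
      countBelow f m                                    ≤⟨ m≤m+n _ _ ⟩
      countBelow f m + countBelow (f ∘ (m +_)) (n ∸ m) ≡⟨ countBelow-+ m (n ∸ m) ⟨
      countBelow f (m + (n ∸ m))                        ≡⟨ cong (countBelow f) (m+[n∸m]≡n m≤n) ⟩
      countBelow f n                                    ∎
      where open ≤-Reasoning

    countBelow-+-≤ : ∀ m n → countBelow f (m + n) ≤ countBelow f m + n
    countBelow-+-≤ m n = begin
      countBelow f (m + n)                           ≡⟨ countBelow-+ m n ⟩
      countBelow f m + countBelow (f ∘ (m +_)) n      ≤⟨ +-monoʳ-≤ _ (countBelow-≤ _ n) ⟩
      countBelow f m + n                             ∎
      where open ≤-Reasoning

  countBelow-cong : ∀ {f g} n → (∀ {y} → y < n → f y ≡ g y) → countBelow f n ≡ countBelow g n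
  countBelow-cong zero    _   = refl
  countBelow-cong (suc n) f≗g rewrite f≗g ≤-refl =
    cong (λ c → if _ then suc c else c) (countBelow-cong n (f≗g ∘ m<n⇒m<1+n))

  countBelow-mono : ∀ {f g} n → (∀ {y} → y < n → T (f y) → T (g y)) → countBelow f n ≤ countBelow g n
  countBelow-mono zero    _   = z≤n
  countBelow-mono {f} {g} (suc n) f⊆g = step (f⊆g ≤-refl) (countBelow-mono n (f⊆g ∘ m<n⇒m<1+n))
    where
    step : ∀ {a b c d} → (T a → T b) → c ≤ d → (if a then suc c else c) ≤ (if b then suc d else d)
    step {false} {false} _ c≤d = c≤d
    step {false} {true}  _ c≤d = m≤n⇒m≤1+n c≤d
    step {true}  {true}  _ c≤d = s≤s c≤d
    step {true}  {false} a⇒b _ = ⊥-elim (a⇒b _)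

  countBelow-∨ : ∀ f g n → countBelow (λ y → f y ∨ g y) n ≤ countBelow f n + countBelow g n
  countBelow-∨ f g zero    = z≤n
  countBelow-∨ f g (suc n) = step (f n) (g n) (countBelow-∨ f g n)
    where
    step : ∀ a b {c d e} → c ≤ d + e →
           (if a ∨ b then suc c else c) ≤ (if a then suc d else d) + (if b then suc e else e)
    step true  false c≤d+e = s≤s c≤d+e
    step true  true  c≤d+e = s≤s (≤-trans c≤d+e (+-monoʳ-≤ _ (n≤1+n _)))
    step false true  {c} {d} {e} c≤d+e = subst (suc c ≤_) (sym (+-suc d e)) (s≤s c≤d+e)
    step false false c≤d+e = c≤d+e

  countBelow-⊆∪ : ∀ {f g h} n → (∀ {y} → y < n → T (f y) → T (g y) ⊎ T (h y)) →
                  countBelow f n ≤ countBelow g n + countBelow h n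
  countBelow-⊆∪ {f} {g} {h} n f⊆g∪h =
    ≤-trans (countBelow-mono n (λ y<n → Equivalence.from T-∨ ∘ f⊆g∪h y<n)) (countBelow-∨ g h n)

  countBelow-translate : ∀ {f g} t n → (∀ {y} → T (f y) → T (g (y + t))) → countBelow f n ≤ countBelow g n + t
  countBelow-translate {f} {g} t n f⊆g-t = begin
    countBelow f n                               ≤⟨ countBelow-mono n (λ {y} _ fy → subst (T ∘ g) (+-comm y t) (f⊆g-t fy)) ⟩
    countBelow (g ∘ (t +_)) n                    ≤⟨ m≤n+m _ (countBelow g t) ⟩
    countBelow g t + countBelow (g ∘ (t +_)) n   ≡⟨ countBelow-+ g t n ⟨
    countBelow g (t + n)                         ≡⟨ cong (countBelow g) (+-comm t n) ⟩
    countBelow g (n + t)                         ≤⟨ countBelow-+-≤ g n t ⟩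
    countBelow g n + t                           ∎
    where open ≤-Reasoning

  countBelow-< : ∀ c n → countBelow (λ y → ⌊ y <? c ⌋) n ≡ c ⊓ n
  countBelow-< c zero = sym (⊓-zeroʳ c)
  countBelow-< c (suc n) with n <? c
  ... | yes n<c = begin
    suc (countBelow _ n) ≡⟨ cong suc (countBelow-< c n) ⟩
    suc (c ⊓ n)          ≡⟨ cong suc (m≥n⇒m⊓n≡n (<⇒≤ n<c)) ⟩
    suc n                ≡⟨ m≥n⇒m⊓n≡n n<c ⟨
    c ⊓ suc n            ∎
    where open ≡-Reasoning
  ... | no n≮c = begin
    countBelow _ n ≡⟨ countBelow-< c n ⟩
    c ⊓ n          ≡⟨ m≤n⇒m⊓n≡m (≮⇒≥ n≮c) ⟩
    c              ≡⟨ m≤n⇒m⊓n≡m (m≤n⇒m≤1+n (≮⇒≥ n≮c)) ⟨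
    c ⊓ suc n      ∎
    where open ≡-Reasoning

  module _ {g : ℕ → Bool} {P : ℕ} (periodic : ∀ y → g (P + y) ≡ g y) where

    countBelow-periodic : ∀ q r → countBelow g (q * P + r) ≡ q * countBelow g P + countBelow g r
    countBelow-periodic zero    r = refl
    countBelow-periodic (suc q) r = begin
      countBelow g (P + q * P + r)                          ≡⟨ cong (countBelow g) (+-assoc P (q * P) r) ⟩
      countBelow g (P + (q * P + r))                        ≡⟨ countBelow-+ g P (q * P + r) ⟩
      countBelow g P + countBelow (g ∘ (P +_)) (q * P + r)  ≡⟨ cong (countBelow g P +_) shift ⟩
      countBelow g P + countBelow g (q * P + r)             ≡⟨ cong (countBelow g P +_) (countBelow-periodic q r) ⟩
      countBelow g P + (q * countBelow g P + countBelow g r) ≡⟨ +-assoc (countBelow g P) _ _ ⟨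
      suc q * countBelow g P + countBelow g r               ∎
      where
      open ≡-Reasoning
      shift : countBelow (g ∘ (P +_)) (q * P + r) ≡ countBelow g (q * P + r)
      shift = countBelow-cong (q * P + r) (λ {y} _ → periodic y)

    -- Write m = q P + r with r < P; the q full periods contribute equally to both sides.
    countBelow-periodic-discrepancy : ∀ m .{{_ : NonZero P}} →
      ∣ P * countBelow g m - countBelow g P * m ∣ ≤ P * countBelow g P
    countBelow-periodic-discrepancy m = begin
      ∣ P * countBelow g m - w * m ∣                       ≡⟨ cong₂ (λ a b → ∣ P * a - w * b ∣) count-m m≡qP+r ⟩
      ∣ P * (q * w + countBelow g r) - w * (q * P + r) ∣   ≡⟨ cong₂ ∣_-_∣ (full-periods P q w _) (*-distribˡ-+ w (q * P) r) ⟩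
      ∣ w * (q * P) + P * countBelow g r - w * (q * P) + w * r ∣
                                                           ≡⟨ ∣m+n-m+o∣≡∣n-o∣ (w * (q * P)) _ _ ⟩
      ∣ P * countBelow g r - w * r ∣                       ≤⟨ m,n≤o⇒∣m-n∣≤o P*count≤P*w w*r≤P*w ⟩
      P * w                                                ∎
      where
      open ≤-Reasoning
      w = countBelow g P
      q = m / P
      r = m % P
      r≤P : r ≤ P
      r≤P = <⇒≤ (m%n<n m P)
      m≡qP+r : m ≡ q * P + r
      m≡qP+r = trans (m≡m%n+[m/n]*n m P) (+-comm r (q * P))
      count-m : countBelow g m ≡ q * w + countBelow g r
      count-m = trans (cong (countBelow g) m≡qP+r) (countBelow-periodic q r)
      full-periods : ∀ P q w x → P * (q * w + x) ≡ w * (q * P) + P * x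
      full-periods = solve-∀
      P*count≤P*w : P * countBelow g r ≤ P * w
      P*count≤P*w = *-monoʳ-≤ P (countBelow-monoʳ-≤ g r≤P)
      w*r≤P*w : w * r ≤ P * w
      w*r≤P*w = ≤-trans (*-monoʳ-≤ w r≤P) (≤-reflexive (*-comm w P))

  inInterval : ℕ → ℕ → ℕ → Bool
  inInterval a r y = ⌊ a ≤? y ⌋ ∧ ⌊ y <? a + r ⌋

  inInterval⇒ : ∀ a r y → T (inInterval a r y) → a ≤ y × y < a + r
  inInterval⇒ a r y y∈I with a ≤? y | y <? a + r
  ... | yes a≤y | yes y<a+r = a≤y , y<a+r
  ... | yes _   | no _      = ⊥-elim y∈I
  ... | no _    | _         = ⊥-elim y∈I

  inInterval⇐ : ∀ {a r y} → a ≤ y → y < a + r → T (inInterval a r y)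
  inInterval⇐ {a} {r} {y} a≤y y<a+r with a ≤? y | y <? a + r
  ... | yes _ | yes _     = _
  ... | yes _ | no  y≮a+r = y≮a+r y<a+r
  ... | no a≰y | _        = a≰y a≤y

  inInterval-cancelˡ : ∀ t {a r y} → T (inInterval (t + a) r (t + y)) → T (inInterval a r y)
  inInterval-cancelˡ t {a} {r} {y} t+y∈I with inInterval⇒ (t + a) r (t + y) t+y∈I
  ... | t+a≤t+y , t+y<t+a+r = inInterval⇐ (+-cancelˡ-≤ t a y t+a≤t+y)
                                          (+-cancelˡ-< t y (a + r) (subst (t + y <_) (+-assoc t a r) t+y<t+a+r))

  countBelow-inInterval-0 : ∀ {a r n} → n ≤ a → countBelow (inInterval a r) n ≡ 0
  countBelow-inInterval-0 {a} {r} {n} n≤a = n≤0⇒n≡0 (≤-trans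
    (countBelow-mono n (λ {y} y<n y∈I → contradiction (≤-<-trans (proj₁ (inInterval⇒ a r y y∈I)) y<n) (≤⇒≯ n≤a)))
    (≤-reflexive (countBelow-< 0 n)))

  countBelow-inInterval-≤ : ∀ a r n → countBelow (inInterval a r) n ≤ r
  countBelow-inInterval-≤ a r n with n ≤? a
  ... | yes n≤a = ≤-trans (≤-reflexive (countBelow-inInterval-0 n≤a)) z≤n
  ... | no  n≰a = begin
    countBelow I n                                  ≡⟨ cong (countBelow I) (m+[n∸m]≡n a≤n) ⟨
    countBelow I (a + (n ∸ a))                      ≡⟨ countBelow-+ I a (n ∸ a) ⟩
    countBelow I a + countBelow (I ∘ (a +_)) (n ∸ a) ≡⟨ cong (_+ countBelow (I ∘ (a +_)) (n ∸ a)) nothing-before-a ⟩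
    countBelow (I ∘ (a +_)) (n ∸ a)                 ≤⟨ countBelow-mono (n ∸ a) (λ {y} _ → below-r y) ⟩
    countBelow (λ y → ⌊ y <? r ⌋) (n ∸ a)            ≡⟨ countBelow-< r (n ∸ a) ⟩
    r ⊓ (n ∸ a)                                     ≤⟨ m⊓n≤m r _ ⟩
    r                                               ∎
    where
    open ≤-Reasoning
    I = inInterval a r
    a≤n = <⇒≤ (≰⇒> n≰a)
    nothing-before-a : countBelow I a ≡ 0
    nothing-before-a = countBelow-inInterval-0 {a} {r} ≤-refl
    below-r : ∀ y → T (I (a + y)) → T ⌊ y <? r ⌋
    below-r y a+y∈I = fromWitness (+-cancelˡ-< a y r (proj₂ (inInterval⇒ a r (a + y) a+y∈I)))

  *-countBelow-inInterval : ∀ {k r t a} n → k * r ≤ t + a → k * countBelow (inInterval a r) n ≤ t + n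
  *-countBelow-inInterval {k} {r} {t} {a} n kr≤t+a with n ≤? a
  ... | yes n≤a = subst (λ c → k * c ≤ t + n) (sym (countBelow-inInterval-0 n≤a)) (≤-trans (≤-reflexive (*-zeroʳ k)) z≤n)
  ... | no  n≰a = ≤-trans (*-monoʳ-≤ k (countBelow-inInterval-≤ a r n))
                          (≤-trans kr≤t+a (+-monoʳ-≤ t (<⇒≤ (≰⇒> n≰a))))

  discrepancy : (e d C M : ℕ) → ℕ
  discrepancy e d C M = ∣ C * d - e * M ∣

  discrepancy-+ : ∀ e d C₁ C₂ M₁ M₂ →
    discrepancy e d (C₁ + C₂) (M₁ + M₂) ≤ discrepancy e d C₁ M₁ + discrepancy e d C₂ M₂
  discrepancy-+ e d C₁ C₂ M₁ M₂ =
    subst₂ (λ x y → ∣ x - y ∣ ≤ discrepancy e d C₁ M₁ + discrepancy e d C₂ M₂)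
           (sym (*-distribʳ-+ d C₁ C₂)) (sym (*-distribˡ-+ e M₁ M₂))
           (∣m+n-o+p∣≤∣m-o∣+∣n-p∣ (C₁ * d) (C₂ * d) (e * M₁) (e * M₂))

  discrepancy-≤ : ∀ {e d C M} → C ≤ M → e ≤ d → discrepancy e d C M ≤ M * d
  discrepancy-≤ {e} {d} {C} {M} C≤M e≤d =
    m,n≤o⇒∣m-n∣≤o (*-monoˡ-≤ d C≤M) (≤-trans (*-monoˡ-≤ M e≤d) (≤-reflexive (*-comm d M)))

  discrepancy-count-change : ∀ e d C C′ M → discrepancy e d C′ M ≤ ∣ C′ - C ∣ * d + discrepancy e d C M
  discrepancy-count-change e d C C′ M = begin
    ∣ C′ * d - e * M ∣                      ≤⟨ ∣-∣-triangle (C′ * d) (C * d) (e * M) ⟩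
    ∣ C′ * d - C * d ∣ + ∣ C * d - e * M ∣  ≡⟨ cong (_+ ∣ C * d - e * M ∣) (*-distribʳ-∣-∣ d C′ C) ⟨
    ∣ C′ - C ∣ * d + ∣ C * d - e * M ∣      ∎
    where open ≤-Reasoning

  -- If C d₀ = e₀ M then d₀ · discrepancy e d C M = M · ∣ e₀ d - e d₀ ∣.
  discrepancy-ratio-change : ∀ {e₀ d₀ e d C M k u} .{{_ : NonZero d₀}} → C * d₀ ≡ e₀ * M →
    k * ∣ e₀ * d - e * d₀ ∣ ≤ u * (d₀ * d) → k * discrepancy e d C M ≤ u * (M * d)
  discrepancy-ratio-change {e₀} {d₀} {e} {d} {C} {M} {k} {u} C≡e₀/d₀ ratios-close = *-cancelˡ-≤ d₀ (begin
    d₀ * (k * ∣ C * d - e * M ∣)              ≡⟨ x*[y*z]≡y*[x*z] d₀ k _ ⟩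
    k * (d₀ * ∣ C * d - e * M ∣)              ≡⟨ cong (k *_) (*-distribˡ-∣-∣ d₀ (C * d) (e * M)) ⟩
    k * ∣ d₀ * (C * d) - d₀ * (e * M) ∣       ≡⟨ cong₂ (λ x y → k * ∣ x - y ∣) rearrange₁ (rearrange₂ d₀ e M) ⟩
    k * ∣ M * (e₀ * d) - M * (e * d₀) ∣       ≡⟨ cong (k *_) (*-distribˡ-∣-∣ M (e₀ * d) (e * d₀)) ⟨
    k * (M * ∣ e₀ * d - e * d₀ ∣)             ≡⟨ x*[y*z]≡y*[x*z] k M _ ⟩
    M * (k * ∣ e₀ * d - e * d₀ ∣)             ≤⟨ *-monoʳ-≤ M ratios-close ⟩
    M * (u * (d₀ * d))                        ≡⟨ rearrange₃ M u d₀ d ⟩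
    d₀ * (u * (M * d))                        ∎)
    where
    open ≤-Reasoning
    x*[y*z]≡y*[x*z] : ∀ x y z → x * (y * z) ≡ y * (x * z)
    x*[y*z]≡y*[x*z] = solve-∀
    rearrange₁ : d₀ * (C * d) ≡ M * (e₀ * d)
    rearrange₁ = begin-equality
      d₀ * (C * d)  ≡⟨ x*[y*z]≡y*x*z d₀ C d ⟩
      C * d₀ * d    ≡⟨ cong (_* d) C≡e₀/d₀ ⟩
      e₀ * M * d    ≡⟨ x*y*z≡y*[x*z] e₀ M d ⟩
      M * (e₀ * d)  ∎
      where
      x*[y*z]≡y*x*z : ∀ x y z → x * (y * z) ≡ y * x * z
      x*[y*z]≡y*x*z = solve-∀
      x*y*z≡y*[x*z] : ∀ x y z → x * y * z ≡ y * (x * z)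
      x*y*z≡y*[x*z] = solve-∀
    rearrange₂ : ∀ d₀ e M → d₀ * (e * M) ≡ M * (e * d₀)
    rearrange₂ = solve-∀
    rearrange₃ : ∀ M u d₀ d → M * (u * (d₀ * d)) ≡ d₀ * (u * (M * d))
    rearrange₃ = solve-∀

module Sumsets where

  open import Data.Bool.Base using (Bool; false; T; _∧_)
  open import Data.Bool.Properties using (T-∧)
  open import Data.List.Base using (upTo)
  open import Data.List.Membership.Propositional using (find; lose)
  open import Data.List.Membership.Propositional.Properties using (∈-upTo⁺; ∈-upTo⁻)
  open import Data.List.Relation.Unary.Any.Properties using (any⁺; any⁻)
  open import Data.Nat.Base
  open import Data.Nat.Properties
  open import Data.Product using (Σ; _×_; _,_)
  open import Function using (_∘_; module Equivalence)
  open import Relation.Binary.PropositionalEquality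

  shiftUp : (ℕ → Bool) → Subset
  shiftUp f zero    = false
  shiftUp f (suc x) = f x

  shiftUp-⊕⁻ : ∀ f g x → T ((shiftUp f ⊕ g) (suc x)) → Σ ℕ λ a → Σ ℕ λ b → a + b ≡ x × T (f a) × T (g b)
  shiftUp-⊕⁻ f g x x∈f+g with find (any⁻ (λ a → shiftUp f a ∧ g (suc x ∸ a)) (upTo (suc (suc x))) x∈f+g)
  ... | zero  , _ , ()
  ... | suc a , a+1∈ , a∈f∧x-a∈g with Equivalence.to T-∧ a∈f∧x-a∈g
  ...   | a∈f , x-a∈g = a , x ∸ a , m+[n∸m]≡n (s≤s⁻¹ (s≤s⁻¹ (∈-upTo⁻ a+1∈))) , a∈f , x-a∈g

  shiftUp-⊕⁺ : ∀ f g {a b} → T (f a) → T (g b) → T ((shiftUp f ⊕ g) (suc (a + b)))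
  shiftUp-⊕⁺ f g {a} {b} a∈f b∈g = any⁺ (λ a′ → shiftUp f a′ ∧ g (suc (a + b) ∸ a′))
    (lose (∈-upTo⁺ (s≤s (s≤s (m≤m+n a b))))
          (Equivalence.from (T-∧ {f a}) (a∈f , subst (T ∘ g) (sym (m+n∸m≡n a b)) b∈g)))

module Blocks where

  open import Data.Bool.Base using (if_then_else_)
  open import Data.Nat.Base
  open import Data.Nat.Properties
  open import Data.Product using (_×_; _,_; proj₁; proj₂)
  open import Data.Sum using (inj₁; inj₂)
  open import Relation.Nullary.Decidable using (yes; no; ⌊_⌋)
  open import Relation.Binary.PropositionalEquality

  module BlockIndex (t : ℕ → ℕ) (t-zero : t 0 ≡ 0) (t-increasing : ∀ J → t J < t (suc J)) where

    t-mono : ∀ {I J} → I ≤ J → t I ≤ t J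
    t-mono {J = zero}  z≤n = ≤-refl
    t-mono {I} {suc J} I≤1+J with m≤n⇒m<n∨m≡n I≤1+J
    ... | inj₁ (s≤s I≤J) = ≤-trans (t-mono I≤J) (<⇒≤ (t-increasing J))
    ... | inj₂ refl      = ≤-refl

    block : ℕ → ℕ
    block zero    = 0
    block (suc x) = if ⌊ t (suc (block x)) ≤? suc x ⌋ then suc (block x) else block x

    block-spec : ∀ x → t (block x) ≤ x × x < t (suc (block x))
    block-spec zero = ≤-reflexive t-zero , subst (_< t 1) t-zero (t-increasing 0)
    block-spec (suc x) with t (suc (block x)) ≤? suc x | block-spec x
    ... | yes t≤1+x | _ , x<t = t≤1+x , subst (_< t (suc (suc (block x)))) (≤-antisym t≤1+x x<t)
                                                (t-increasing (suc (block x)))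
    ... | no  t≰1+x | t≤x , _ = m≤n⇒m≤1+n t≤x , ≰⇒> t≰1+x

    block-≥ : ∀ {J x} → t J ≤ x → J ≤ block x
    block-≥ {J} {x} t≤x = ≮⇒≥ λ b<J → <⇒≱ (proj₂ (block-spec x)) (≤-trans (t-mono b<J) t≤x)

    block-≤ : ∀ {J x} → x < t (suc J) → block x ≤ J
    block-≤ {J} {x} x<t = ≮⇒≥ λ J<b → <⇒≱ x<t (≤-trans (t-mono J<b) (proj₁ (block-spec x)))

    block-unique : ∀ {J x} → t J ≤ x → x < t (suc J) → block x ≡ J
    block-unique t≤x x<t = ≤-antisym (block-≤ x<t) (block-≥ t≤x)

    block-mono : ∀ {x y} → x ≤ y → block x ≤ block y
    block-mono {x} x≤y = block-≥ (≤-trans (proj₁ (block-spec x)) x≤y)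

module Ratios where

  open import Data.Nat.Base

  record SlowlyVaryingFractions : Set where
    field
      num den-1 : ℕ → ℕ
      num≤den : ∀ J → num J ≤ suc (den-1 J)
      slowly-varying : ∀ J →
        suc J * ∣ num J * suc (den-1 (suc J)) - num (suc J) * suc (den-1 J) ∣
          ≤ 4 * (suc (den-1 J) * suc (den-1 (suc J)))

open Ratios using (SlowlyVaryingFractions)

module Construction (F : SlowlyVaryingFractions) where

  open import Data.Bool.Base using (Bool; true; false; T; _∨_)
  open import Data.Bool.Properties using (T-≡; T-∨; ¬-not)
  open import Data.Nat.Base
  open import Data.Nat.Properties
  open import Data.Nat.DivMod
  open import Data.Nat.Divisibility using (_∣_; divides; ∣-refl; n∣m*n; m∣m*n; ∣m⇒∣m*n; ∣m+n∣m⇒∣n)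
  open import Data.Nat.Tactic.RingSolver using (solve-∀)
  open import Data.Product using (Σ; _×_; _,_; proj₁; proj₂)
  open import Data.Sum using (_⊎_; inj₁; inj₂; [_,_]′)
  import Data.Sum
  open import Function using (_∘_; module Equivalence)
  open import Relation.Nullary.Decidable using (Dec; yes; no; ⌊_⌋; toWitness)
  open import Relation.Binary.PropositionalEquality hiding (J)
  open NatArithmetic
  open Counting
  open Sumsets

  open SlowlyVaryingFractions F renaming (num to e)

  d : ℕ → ℕ
  d J = suc (den-1 J)

  -- Block J is [τ J, τ (1 + J)). On it A₀ repeats [0, c J) modulo P J, of density c J / P J = e J / d J,
  -- B consists of s J, …, s J + J, and the window width ρ J exceeds every earlier element of B.
  -- parameters J = (ρ J ∸ 1 , τ J) is computed with the formulas for P, s and G below; it is opaque,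
  -- and used only through ρ-zero, ρ-suc, τ-zero and τ-suc, because unfolding τ makes terms explode.
  opaque
    parameters : ℕ → ℕ × ℕ
    parameters zero    = 0 , 0
    parameters (suc J) = r′ , Pᴶ * (d (suc J) * (suc (suc J) * suc r′)) * (suc (suc J) * (suc J + sᴶ))
      where
      r t Pᴶ sᴶ r′ : ℕ
      r = proj₁ (parameters J)
      t = proj₂ (parameters J)
      Pᴶ = d J * (suc J * suc r)
      sᴶ = Pᴶ * (suc J * (t + suc J))
      r′ = sᴶ + suc J

  ρ τ : ℕ → ℕ
  ρ J = suc (proj₁ (parameters J))
  τ J = proj₂ (parameters J)

  K P c s G : ℕ → ℕ
  K J = suc J * ρ J
  P J = d J * K J
  c J = e J * K J
  s J = P J * (suc J * (τ J + suc J))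
  G J = suc (suc J) * (suc J + s J)

  opaque
    unfolding parameters

    ρ-zero : ρ 0 ≡ 1
    ρ-zero = refl

    ρ-suc : ∀ J → ρ (suc J) ≡ suc (s J + suc J)
    ρ-suc J = refl

    τ-zero : τ 0 ≡ 0
    τ-zero = refl

    τ-suc : ∀ J → τ (suc J) ≡ P J * P (suc J) * G J
    τ-suc J = refl

  s-large : ∀ J → suc J * (τ J + suc J) ≤ s J
  s-large J = m≤n*m (suc J * (τ J + suc J)) (P J)

  τ<s : ∀ J → τ J < s J
  τ<s J = begin-strict
    τ J                    <⟨ m<m+n (τ J) z<s ⟩
    τ J + suc J            ≤⟨ m≤n*m (τ J + suc J) (suc J) ⟩
    suc J * (τ J + suc J)  ≤⟨ s-large J ⟩
    s J                    ∎
    where open ≤-Reasoning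

  G≤τ[1+J] : ∀ J → G J ≤ τ (suc J)
  G≤τ[1+J] J = subst (G J ≤_) (sym (τ-suc J)) (m≤n*m (G J) (P J * P (suc J)))

  s+J<τ[1+J] : ∀ J → s J + suc J ≤ τ (suc J)
  s+J<τ[1+J] J = ≤-trans (≤-reflexive (+-comm (s J) (suc J))) (≤-trans (m≤n*m (suc J + s J) (suc (suc J))) (G≤τ[1+J] J))

  s<τ[1+J] : ∀ J → s J < τ (suc J)
  s<τ[1+J] J = <-≤-trans (m<m+n (s J) z<s) (s+J<τ[1+J] J)

  [2+J]*s≤τ[1+J] : ∀ J → suc (suc J) * s J ≤ τ (suc J)
  [2+J]*s≤τ[1+J] J = ≤-trans (*-monoʳ-≤ (suc (suc J)) (m≤n+m (s J) (suc J))) (G≤τ[1+J] J)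

  [1+J]*τ≤τ[1+J] : ∀ J → suc J * τ J ≤ τ (suc J)
  [1+J]*τ≤τ[1+J] J = ≤-trans (*-mono-≤ (n≤1+n (suc J)) (<⇒≤ (τ<s J))) ([2+J]*s≤τ[1+J] J)

  τ<τ[1+J] : ∀ J → τ J < τ (suc J)
  τ<τ[1+J] J = <-trans (τ<s J) (s<τ[1+J] J)

  open Blocks.BlockIndex τ τ-zero τ<τ[1+J] public renaming (t-mono to τ-mono)

  s-mono : ∀ {I J} → I ≤ J → s I ≤ s J
  s-mono {I} {J} I≤J with m≤n⇒m<n∨m≡n I≤J
  ... | inj₁ I<J  = <⇒≤ (<-≤-trans (s<τ[1+J] I) (≤-trans (τ-mono I<J) (<⇒≤ (τ<s J))))
  ... | inj₂ refl = ≤-refl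

  [2+J]*P[1+J]≤τ[1+J] : ∀ J → suc (suc J) * P (suc J) ≤ τ (suc J)
  [2+J]*P[1+J]≤τ[1+J] J = begin
    suc (suc J) * P (suc J)   ≡⟨ *-comm (suc (suc J)) (P (suc J)) ⟩
    P (suc J) * suc (suc J)   ≤⟨ *-monoʳ-≤ (P (suc J)) (m≤m*n (suc (suc J)) (suc J + s J)) ⟩
    P (suc J) * G J           ≤⟨ m≤n*m (P (suc J) * G J) (P J) ⟩
    P J * (P (suc J) * G J)   ≡⟨ *-assoc (P J) (P (suc J)) (G J) ⟨
    P J * P (suc J) * G J     ≡⟨ τ-suc J ⟨
    τ (suc J)                 ∎
    where open ≤-Reasoning

  P≤τ[1+J] : ∀ J → P J ≤ τ (suc J)
  P≤τ[1+J] J = subst (P J ≤_) (sym (τ-suc J)) (≤-trans (m≤m*n (P J) (P (suc J))) (m≤m*n (P J * P (suc J)) (G J)))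

  K≤P : ∀ J → K J ≤ P J
  K≤P J = m≤n*m (K J) (d J)

  c≤P : ∀ J → c J ≤ P J
  c≤P J = *-monoˡ-≤ (K J) (num≤den J)

  J<ρ : ∀ J → J < ρ J
  J<ρ zero    = subst (0 <_) (sym ρ-zero) z<s
  J<ρ (suc J) = subst (suc J <_) (sym (ρ-suc J)) (s≤s (m≤n+m (suc J) (s J)))

  s+I<ρ : ∀ {I J} → I < J → s I + I < ρ J
  s+I<ρ {I} {suc J} (s≤s I≤J) = subst (s I + I <_) (sym (ρ-suc J)) (s≤s (+-mono-≤ (s-mono I≤J) (m≤n⇒m≤1+n I≤J)))

  P∣τ : ∀ J → P J ∣ τ J
  P∣τ zero    = subst (P 0 ∣_) (sym τ-zero) (divides 0 refl)
  P∣τ (suc J) = subst (P (suc J) ∣_) (sym (τ-suc J)) (∣m⇒∣m*n (G J) (n∣m*n (P J)))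

  P∣τ[1+J] : ∀ J → P J ∣ τ (suc J)
  P∣τ[1+J] J = subst (P J ∣_) (sym (τ-suc J)) (∣m⇒∣m*n (G J) (m∣m*n (P (suc J))))

  P∣s : ∀ J → P J ∣ s J
  P∣s J = m∣m*n (suc J * (τ J + suc J))

  byBlock : (ℕ → ℕ → Bool) → ℕ → Bool
  byBlock R x = R (block x) x

  A-pattern : ℕ → ℕ → Bool
  A-pattern J y = ⌊ y % P J <? c J ⌋

  window : ℕ → ℕ → Bool
  window J y = inInterval (c J) (ρ J) (y % P J)

  B-interval : ℕ → ℕ → Bool
  B-interval J = inInterval (s J) (suc J)

  exceptional : ℕ → ℕ → Bool
  exceptional J x = window J x ∨ inInterval (s J) (τ J + suc J) x

  A₀ E₀ : ℕ → Bool
  A₀ = byBlock A-pattern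
  E₀ = byBlock exceptional

  A : Subset
  A = shiftUp A₀

  B : Subset
  B = byBlock B-interval

  -- A₀ and X₀ are A and A ⊕ B shifted down by one, while B is not shifted: a ∈ A₀, b ∈ B give a + b ∈ X₀.
  X₀ : ℕ → Bool
  X₀ x = (A ⊕ B) (suc x)

  B-elim : ∀ {b} → T (B b) → s (block b) ≤ b × b ≤ s (block b) + block b
  B-elim {b} b∈B = proj₁ b∈I , s≤s⁻¹ (subst (b <_) (+-suc (s I) I) (proj₂ b∈I))
    where
    I = block b
    b∈I : s I ≤ b × b < s I + suc I
    b∈I = inInterval⇒ (s I) (suc I) b b∈B

  B-zero : B 0 ≡ false
  B-zero = ¬-not λ B0≡true → <⇒≱ (≤-<-trans z≤n (τ<s 0)) (proj₁ (B-elim (Equivalence.from T-≡ B0≡true)))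

  B-intro : ∀ {J n} → s J ≤ n → n ≤ s J + J → T (B n)
  B-intro {J} {n} s≤n n≤s+J = subst (λ I → T (B-interval I n)) (sym block-n≡J)
    (inInterval⇐ s≤n (≤-<-trans n≤s+J (+-monoʳ-< (s J) (n<1+n J))))
    where
    block-n≡J : block n ≡ J
    block-n≡J = block-unique (≤-trans (<⇒≤ (τ<s J)) s≤n)
                             (<-≤-trans (≤-<-trans n≤s+J (+-monoʳ-< (s J) (n<1+n J))) (s+J<τ[1+J] J))

  -- With J = 1 + a + b, B contains the J + 1 > a consecutive numbers s J, …, s J + J, all beyond (1 + a) + (1 + b).
  B-meets-residue-classes : ∀ a b → Σ ℕ λ n → B (suc a * suc n + suc b) ≡ true
  B-meets-residue-classes a b = n , Equivalence.to T-≡ (B-intro s≤v v≤s+J)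
    where
    J = suc (a + b)
    r = suc a + suc b
    r≤s : r ≤ s J
    r≤s = begin
      suc a + suc b          ≡⟨ +-suc (suc a) b ⟩
      suc J                  ≤⟨ m≤n+m (suc J) (τ J) ⟩
      τ J + suc J            ≤⟨ m≤n*m (τ J + suc J) (suc J) ⟩
      suc J * (τ J + suc J)  ≤⟨ s-large J ⟩
      s J                    ∎
      where open ≤-Reasoning
    z = s J ∸ r
    n = proj₁ (multiple-in-window z a)
    v = suc a * suc n + suc b
    v≡nq+r : v ≡ n * suc a + r
    v≡nq+r = rearrange a b n
      where
      rearrange : ∀ a b n → suc a * suc n + suc b ≡ n * suc a + (suc a + suc b)
      rearrange = solve-∀
    s≤v : s J ≤ v
    s≤v = begin
      s J               ≡⟨ m∸n+n≡m r≤s ⟨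
      z + r             ≤⟨ +-monoˡ-≤ r (proj₁ (proj₂ (multiple-in-window z a))) ⟩
      n * suc a + r     ≡⟨ v≡nq+r ⟨
      v                 ∎
      where open ≤-Reasoning
    v≤s+J : v ≤ s J + J
    v≤s+J = begin
      v                 ≡⟨ v≡nq+r ⟩
      n * suc a + r     ≤⟨ +-monoˡ-≤ r (proj₂ (proj₂ (multiple-in-window z a))) ⟩
      z + a + r         ≡⟨ +-assoc z a r ⟩
      z + (a + r)       ≡⟨ cong (z +_) (+-comm a r) ⟩
      z + (r + a)       ≡⟨ +-assoc z r a ⟨
      z + r + a         ≡⟨ cong (_+ a) (m∸n+n≡m r≤s) ⟩
      s J + a           ≤⟨ +-monoʳ-≤ (s J) (≤-trans (m≤m+n a b) (n≤1+n (a + b))) ⟩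
      s J + J           ∎
      where open ≤-Reasoning

  A-or-window : ∀ J y → y % P J < c J + ρ J → T (A-pattern J y) ⊎ T (window J y)
  A-or-window J y y%P<c+ρ = decide (y % P J <? c J)
    where
    decide : (y%P<c? : Dec (y % P J < c J)) → T ⌊ y%P<c? ⌋ ⊎ T (window J y)
    decide (yes _)     = inj₁ _
    decide (no y%P≮c) = inj₂ (inInterval⇐ (≮⇒≥ y%P≮c) y%P<c+ρ)

  B-mod-P<ρ : ∀ {b J} → T (B b) → block b ≤ J → b % P J < ρ J
  B-mod-P<ρ {b} {J} b∈B I≤J = [ earlier , same ]′ (m≤n⇒m<n∨m≡n I≤J)
    where
    I = block b
    earlier : I < J → b % P J < ρ J
    earlier I<J = ≤-<-trans (m%n≤m b (P J)) (≤-<-trans (proj₂ (B-elim b∈B)) (s+I<ρ I<J))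
    same : I ≡ J → b % P J < ρ J
    same I≡J = subst (λ J → b % P J < ρ J) I≡J (begin-strict
      b % P I                 ≡⟨ cong (_% P I) (m+[n∸m]≡n (proj₁ (B-elim b∈B))) ⟨
      (s I + (b ∸ s I)) % P I ≡⟨ %-remove-+ˡ (b ∸ s I) (P∣s I) ⟩
      (b ∸ s I) % P I         ≤⟨ m%n≤m (b ∸ s I) (P I) ⟩
      b ∸ s I                 ≤⟨ m≤n+o⇒m∸n≤o b (s I) (proj₂ (B-elim b∈B)) ⟩
      I                       <⟨ J<ρ I ⟩
      ρ I                     ∎)
      where open ≤-Reasoning

  module _ {a b : ℕ} (a∈A : T (A₀ a)) (b∈B : T (B b)) where

    private
      J = block (a + b)
      I≤J : block b ≤ J
      I≤J = block-mono (m≤n+m b a)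

    sum-from-same-block : τ J ≤ a → (a + b) % P J < c J + ρ J
    sum-from-same-block τ≤a = begin-strict
      (a + b) % P J             ≡⟨ %-distribˡ-+ a b (P J) ⟩
      (a % P J + b % P J) % P J ≤⟨ m%n≤m (a % P J + b % P J) (P J) ⟩
      a % P J + b % P J         <⟨ +-mono-<-≤ a%P<c (<⇒≤ (B-mod-P<ρ b∈B I≤J)) ⟩
      c J + ρ J                 ∎
      where
      open ≤-Reasoning
      block-a : block a ≡ J
      block-a = block-unique τ≤a (≤-<-trans (m≤m+n a b) (proj₂ (block-spec (a + b))))
      a%P<c : a % P J < c J
      a%P<c = toWitness (subst (λ I → T (A-pattern I a)) block-a a∈A)

    sum-from-earlier-blocks : a < τ J → block b < J → (a + b) % P J < c J + ρ J
    sum-from-earlier-blocks a<τ I<J = begin-strict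
      (a + b) % P J                 ≡⟨ cong (_% P J) (m+[n∸m]≡n τ≤x) ⟨
      (τ J + (a + b ∸ τ J)) % P J  ≡⟨ %-remove-+ˡ (a + b ∸ τ J) (P∣τ J) ⟩
      (a + b ∸ τ J) % P J          ≤⟨ m%n≤m (a + b ∸ τ J) (P J) ⟩
      a + b ∸ τ J                  <⟨ ∸-monoˡ-< (+-mono-<-≤ a<τ (<⇒≤ b<ρ)) τ≤x ⟩
      τ J + ρ J ∸ τ J              ≡⟨ m+n∸m≡n (τ J) (ρ J) ⟩
      ρ J                          ≤⟨ m≤n+m (ρ J) (c J) ⟩
      c J + ρ J                    ∎
      where
      open ≤-Reasoning
      τ≤x = proj₁ (block-spec (a + b))
      b<ρ : b < ρ J
      b<ρ = ≤-<-trans (proj₂ (B-elim b∈B)) (s+I<ρ I<J)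

    sum-near-s : a < τ J → block b ≡ J → T (inInterval (s J) (τ J + suc J) (a + b))
    sum-near-s a<τ I≡J = inInterval⇐ (≤-trans s≤b (m≤n+m b a)) (begin-strict
      a + b                   <⟨ +-mono-<-≤ a<τ b≤s+J ⟩
      τ J + (s J + J)         <⟨ +-monoʳ-< (τ J) (+-monoʳ-< (s J) (n<1+n J)) ⟩
      τ J + (s J + suc J)     ≡⟨ x+[y+z]≡y+[x+z] (τ J) (s J) (suc J) ⟩
      s J + (τ J + suc J)     ∎)
      where
      open ≤-Reasoning
      s≤b : s J ≤ b
      s≤b = subst (λ I → s I ≤ b) I≡J (proj₁ (B-elim b∈B))
      b≤s+J : b ≤ s J + J
      b≤s+J = subst (λ I → b ≤ s I + I) I≡J (proj₂ (B-elim b∈B))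
      x+[y+z]≡y+[x+z] : ∀ x y z → x + (y + z) ≡ y + (x + z)
      x+[y+z]≡y+[x+z] = solve-∀

    sum∈A∪E : T (A₀ (a + b)) ⊎ T (E₀ (a + b))
    sum∈A∪E = [ from-near-pattern ∘ sum-from-same-block , from-earlier-block ]′ (≤-<-connex (τ J) a)
      where
      from-near-pattern : (a + b) % P J < c J + ρ J → T (A₀ (a + b)) ⊎ T (E₀ (a + b))
      from-near-pattern lt = Data.Sum.map₂ (λ in-window → Equivalence.from T-∨ (inj₁ in-window)) (A-or-window J (a + b) lt)
      from-near-s : T (inInterval (s J) (τ J + suc J) (a + b)) → T (A₀ (a + b)) ⊎ T (E₀ (a + b))
      from-near-s in-interval = inj₂ (Equivalence.from (T-∨ {window J (a + b)}) (inj₂ in-interval))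
      from-earlier-block : a < τ J → T (A₀ (a + b)) ⊎ T (E₀ (a + b))
      from-earlier-block a<τ = [ from-near-pattern ∘ sum-from-earlier-blocks a<τ , from-near-s ∘ sum-near-s a<τ ]′
                                 (m≤n⇒m<n∨m≡n I≤J)

  X⊆A∪E : ∀ {x} → T (X₀ x) → T (A₀ x) ⊎ T (E₀ x)
  X⊆A∪E {x} x∈X = from-summands (shiftUp-⊕⁻ A₀ B x x∈X)
    where
    from-summands : (Σ ℕ λ a → Σ ℕ λ b → a + b ≡ x × T (A₀ a) × T (B b)) →
                    T (A₀ x) ⊎ T (E₀ x)
    from-summands (a , b , a+b≡x , a∈A , b∈B) =
      subst (λ x → T (A₀ x) ⊎ T (E₀ x)) a+b≡x (sum∈A∪E a∈A b∈B)

  A+s₀⊆X : ∀ {y} → T (A₀ y) → T (X₀ (y + s 0))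
  A+s₀⊆X {y} y∈A = shiftUp-⊕⁺ A₀ B {y} {s 0} y∈A (B-intro ≤-refl (m≤m+n (s 0) 0))

  L : ℕ → ℕ
  L J = τ (suc J) ∸ τ J

  τ+L≡τ[1+J] : ∀ J → τ J + L J ≡ τ (suc J)
  τ+L≡τ[1+J] J = m+[n∸m]≡n (<⇒≤ (τ<τ[1+J] J))

  P∣L : ∀ J → P J ∣ L J
  P∣L J = ∣m+n∣m⇒∣n (subst (P J ∣_) (sym (τ+L≡τ[1+J] J)) (P∣τ[1+J] J)) (P∣τ J)

  module _ {J y : ℕ} (y<L : y < L J) where

    block-local : block (τ J + y) ≡ J
    block-local = block-unique (m≤m+n (τ J) y) (subst (τ J + y <_) (τ+L≡τ[1+J] J) (+-monoʳ-< (τ J) y<L))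

    A-local : A₀ (τ J + y) ≡ A-pattern J y
    A-local = trans (cong (λ I → A-pattern I (τ J + y)) block-local)
                    (cong (λ r → ⌊ r <? c J ⌋) (%-remove-+ˡ y (P∣τ J)))

    E-local : T (E₀ (τ J + y)) → T (window J y) ⊎ T (inInterval (s J ∸ τ J) (τ J + suc J) y)
    E-local x∈E = Data.Sum.map in-window in-interval
                    (Equivalence.to T-∨ (subst (λ I → T (exceptional I (τ J + y))) block-local x∈E))
      where
      in-window : T (window J (τ J + y)) → T (window J y)
      in-window = subst (λ r → T (inInterval (c J) (ρ J) r)) (%-remove-+ˡ y (P∣τ J))
      s≡τ+[s-τ] : s J ≡ τ J + (s J ∸ τ J)
      s≡τ+[s-τ] = sym (m+[n∸m]≡n (<⇒≤ (τ<s J)))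
      in-interval : T (inInterval (s J) (τ J + suc J) (τ J + y)) → T (inInterval (s J ∸ τ J) (τ J + suc J) y)
      in-interval = inInterval-cancelˡ (τ J) ∘ subst (λ a → T (inInterval a (τ J + suc J) (τ J + y))) s≡τ+[s-τ]

  A-pattern-periodic : ∀ J y → A-pattern J (P J + y) ≡ A-pattern J y
  A-pattern-periodic J y = cong (λ r → ⌊ r <? c J ⌋) (%-remove-+ˡ y (∣-refl {P J}))

  window-periodic : ∀ J y → window J (P J + y) ≡ window J y
  window-periodic J y = cong (inInterval (c J) (ρ J)) (%-remove-+ˡ y (∣-refl {P J}))

  A-pattern-per-period : ∀ J → countBelow (A-pattern J) (P J) ≡ c J
  A-pattern-per-period J = begin-equality
    countBelow (A-pattern J) (P J)             ≡⟨ countBelow-cong (P J) (λ y<P → cong (λ r → ⌊ r <? c J ⌋) (m<n⇒m%n≡m y<P)) ⟩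
    countBelow (λ y → ⌊ y <? c J ⌋) (P J)       ≡⟨ countBelow-< (c J) (P J) ⟩
    c J ⊓ P J                                  ≡⟨ m≤n⇒m⊓n≡m (c≤P J) ⟩
    c J                                        ∎
    where open ≤-Reasoning

  window-per-period : ∀ J → countBelow (window J) (P J) ≤ ρ J
  window-per-period J = begin
    countBelow (window J) (P J)                ≡⟨ countBelow-cong (P J) (λ y<P → cong (inInterval (c J) (ρ J)) (m<n⇒m%n≡m y<P)) ⟩
    countBelow (inInterval (c J) (ρ J)) (P J)  ≤⟨ countBelow-inInterval-≤ (c J) (ρ J) (P J) ⟩
    ρ J                                        ∎
    where open ≤-Reasoning

  A-pattern-exact : ∀ J {m} → P J ∣ m → countBelow (A-pattern J) m * d J ≡ e J * m
  A-pattern-exact J (divides q refl) = begin-equality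
    countBelow (A-pattern J) (q * P J) * d J          ≡⟨ cong (λ n → countBelow (A-pattern J) n * d J) (+-identityʳ (q * P J)) ⟨
    countBelow (A-pattern J) (q * P J + 0) * d J      ≡⟨ cong (_* d J) (countBelow-periodic (A-pattern-periodic J) q 0) ⟩
    (q * countBelow (A-pattern J) (P J) + 0) * d J    ≡⟨ cong (λ w → (q * w + 0) * d J) (A-pattern-per-period J) ⟩
    (q * c J + 0) * d J                               ≡⟨ rearrange q (e J) (K J) (d J) ⟩
    e J * (q * P J)                                   ∎
    where
    open ≤-Reasoning
    rearrange : ∀ q e K d → (q * (e * K) + 0) * d ≡ e * (q * (d * K))
    rearrange = solve-∀

  A-pattern-discrepancy : ∀ J m → discrepancy (e J) (d J) (countBelow (A-pattern J) m) m ≤ c J * d J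
  A-pattern-discrepancy J m = *-cancelʳ-≤ _ _ (K J) (begin
    ∣ X * d J - e J * m ∣ * K J          ≡⟨ *-distribʳ-∣-∣ (K J) (X * d J) (e J * m) ⟩
    ∣ X * d J * K J - e J * m * K J ∣    ≡⟨ cong₂ ∣_-_∣ (x*y*z≡y*z*x X (d J) (K J)) (x*y*z≡x*z*y (e J) m (K J)) ⟩
    ∣ P J * X - c J * m ∣               ≡⟨ cong (λ w → ∣ P J * X - w * m ∣) (A-pattern-per-period J) ⟨
    ∣ P J * X - w * m ∣                 ≤⟨ countBelow-periodic-discrepancy (A-pattern-periodic J) m ⟩
    P J * w                             ≡⟨ cong (P J *_) (A-pattern-per-period J) ⟩
    P J * c J                           ≡⟨ x*y*z≡z*x*y (d J) (K J) (c J) ⟩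
    c J * d J * K J                     ∎)
    where
    open ≤-Reasoning
    X = countBelow (A-pattern J) m
    w = countBelow (A-pattern J) (P J)
    x*y*z≡y*z*x : ∀ x y z → x * y * z ≡ y * z * x
    x*y*z≡y*z*x = solve-∀
    x*y*z≡x*z*y : ∀ x y z → x * y * z ≡ x * z * y
    x*y*z≡x*z*y = solve-∀
    x*y*z≡z*x*y : ∀ x y z → x * y * z ≡ z * x * y
    x*y*z≡z*x*y = solve-∀

  window-count : ∀ J n → suc J * countBelow (window J) n ≤ n + P J
  window-count J n = *-cancelˡ-≤ (P J) (begin
    P J * (suc J * W)          ≡⟨ x*[y*z]≡y*[x*z] (P J) (suc J) W ⟩
    suc J * (P J * W)          ≤⟨ *-monoʳ-≤ (suc J) P*W≤w*[n+P] ⟩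
    suc J * (w * (n + P J))    ≤⟨ *-monoʳ-≤ (suc J) (*-monoˡ-≤ (n + P J) (window-per-period J)) ⟩
    suc J * (ρ J * (n + P J))  ≡⟨ *-assoc (suc J) (ρ J) (n + P J) ⟨
    K J * (n + P J)            ≤⟨ *-monoˡ-≤ (n + P J) (K≤P J) ⟩
    P J * (n + P J)            ∎)
    where
    open ≤-Reasoning
    W = countBelow (window J) n
    w = countBelow (window J) (P J)
    x*[y*z]≡y*[x*z] : ∀ x y z → x * (y * z) ≡ y * (x * z)
    x*[y*z]≡y*[x*z] = solve-∀
    P*W≤w*[n+P] : P J * W ≤ w * (n + P J)
    P*W≤w*[n+P] = begin
      P J * W                        ≤⟨ m≤n+∣m-n∣ (P J * W) (w * n) ⟩
      w * n + ∣ P J * W - w * n ∣    ≤⟨ +-monoʳ-≤ (w * n) (countBelow-periodic-discrepancy (window-periodic J) n) ⟩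
      w * n + P J * w                ≡⟨ cong (w * n +_) (*-comm (P J) w) ⟩
      w * n + w * P J                ≡⟨ *-distribˡ-+ w n (P J) ⟨
      w * (n + P J)                  ∎

  interval-count : ∀ J n → suc J * countBelow (inInterval (s J ∸ τ J) (τ J + suc J)) n ≤ τ J + n
  interval-count J n = *-countBelow-inInterval {suc J} {τ J + suc J} {τ J} {s J ∸ τ J} n
    (subst (suc J * (τ J + suc J) ≤_) (sym (m+[n∸m]≡n (<⇒≤ (τ<s J)))) (s-large J))

  module AtPosition {N J : ℕ} (block-N : block N ≡ suc J) where

    M m : ℕ
    M = suc N
    m = M ∸ τ (suc J)

    τ[1+J]≤M : τ (suc J) ≤ M
    τ[1+J]≤M = m≤n⇒m≤1+n (subst (λ I → τ I ≤ N) block-N (proj₁ (block-spec N)))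

    m≤L : m ≤ L (suc J)
    m≤L = ∸-monoˡ-≤ (τ (suc J)) (subst (λ I → N < τ (suc I)) block-N (proj₂ (block-spec N)))

    τ+L+m≡M : τ J + L J + m ≡ M
    τ+L+m≡M = trans (cong (_+ m) (τ+L≡τ[1+J] J)) (m+[n∸m]≡n τ[1+J]≤M)

    L≤M : L J ≤ M
    L≤M = ≤-trans (m≤n+m (L J) (τ J)) (≤-trans (≤-reflexive (τ+L≡τ[1+J] J)) τ[1+J]≤M)

    decompose : ∀ g → countBelow g M ≡
      countBelow g (τ J) + countBelow (g ∘ (τ J +_)) (L J) + countBelow (g ∘ (τ (suc J) +_)) m
    decompose g = begin-equality
      countBelow g M                                                          ≡⟨ cong (countBelow g) τ+L+m≡M ⟨
      countBelow g (τ J + L J + m)                                            ≡⟨ countBelow-+ g (τ J + L J) m ⟩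
      countBelow g (τ J + L J) + countBelow (g ∘ (τ J + L J +_)) m            ≡⟨ cong₂ _+_ (countBelow-+ g (τ J) (L J))
                                                                                   (countBelow-cong m (λ {y} _ → cong (λ t → g (t + y)) (τ+L≡τ[1+J] J))) ⟩
      countBelow g (τ J) + countBelow (g ∘ (τ J +_)) (L J) + countBelow (g ∘ (τ (suc J) +_)) m ∎
      where open ≤-Reasoning

    J₁ : ℕ
    J₁ = suc J

    J₁*τ≤M : J₁ * τ J ≤ M
    J₁*τ≤M = ≤-trans ([1+J]*τ≤τ[1+J] J) τ[1+J]≤M

    A-close : J₁ * discrepancy (e J₁) (d J₁) (countBelow (A₀) M) M ≤ 6 * (M * d J₁)
    A-close = begin
      J₁ * D (countBelow A₀ M) M                                  ≡⟨ cong₂ (λ C n → J₁ * D C n) (sym count-A) τ+L+m≡M ⟨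
      J₁ * D (a₀ + a₁ + a₂) (τ J + L J + m)                        ≤⟨ *-monoʳ-≤ J₁ split-discrepancy ⟩
      J₁ * (D a₀ (τ J) + D a₁ (L J) + D a₂ m)                       ≡⟨ *-distrib-+₃ J₁ (D a₀ (τ J)) (D a₁ (L J)) (D a₂ m) ⟩
      J₁ * D a₀ (τ J) + J₁ * D a₁ (L J) + J₁ * D a₂ m                ≤⟨ +-mono-≤ (+-mono-≤ before-previous-block previous-block) current-block ⟩
      M * d J₁ + 4 * (M * d J₁) + M * d J₁                          ≡⟨ x+4x+x≡6x (M * d J₁) ⟩
      6 * (M * d J₁)                                                ∎
      where
      open ≤-Reasoning
      D = discrepancy (e J₁) (d J₁)
      a₀ = countBelow A₀ (τ J)
      a₁ = countBelow (A-pattern J) (L J)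
      a₂ = countBelow (A-pattern J₁) m
      count-A : countBelow A₀ M ≡ a₀ + a₁ + a₂
      count-A = trans (decompose A₀) (cong₂ (λ u v → a₀ + u + v) (countBelow-cong (L J) A-local)
                                                                   (countBelow-cong m (λ y<m → A-local (<-≤-trans y<m m≤L))))
      split-discrepancy : D (a₀ + a₁ + a₂) (τ J + L J + m) ≤ D a₀ (τ J) + D a₁ (L J) + D a₂ m
      split-discrepancy = ≤-trans (discrepancy-+ (e J₁) (d J₁) (a₀ + a₁) a₂ (τ J + L J) m)
                                  (+-monoˡ-≤ (D a₂ m) (discrepancy-+ (e J₁) (d J₁) a₀ a₁ (τ J) (L J)))
      *-distrib-+₃ : ∀ k a b c → k * (a + b + c) ≡ k * a + k * b + k * c
      *-distrib-+₃ = solve-∀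
      x+4x+x≡6x : ∀ x → x + 4 * x + x ≡ 6 * x
      x+4x+x≡6x = solve-∀
      before-previous-block : J₁ * D a₀ (τ J) ≤ M * d J₁
      before-previous-block = begin
        J₁ * D a₀ (τ J)     ≤⟨ *-monoʳ-≤ J₁ (discrepancy-≤ (countBelow-≤ A₀ (τ J)) (num≤den J₁)) ⟩
        J₁ * (τ J * d J₁)   ≡⟨ *-assoc J₁ (τ J) (d J₁) ⟨
        J₁ * τ J * d J₁     ≤⟨ *-monoˡ-≤ (d J₁) J₁*τ≤M ⟩
        M * d J₁            ∎
      previous-block : J₁ * D a₁ (L J) ≤ 4 * (M * d J₁)
      previous-block = ≤-trans
        (discrepancy-ratio-change {e J} {d J} {e J₁} {d J₁} {a₁} {L J} {J₁} {4} (A-pattern-exact J (P∣L J)) (slowly-varying J))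
        (*-monoʳ-≤ 4 (*-monoˡ-≤ (d J₁) L≤M))
      current-block : J₁ * D a₂ m ≤ M * d J₁
      current-block = begin
        J₁ * D a₂ m                 ≤⟨ *-monoʳ-≤ J₁ (A-pattern-discrepancy J₁ m) ⟩
        J₁ * (c J₁ * d J₁)          ≡⟨ *-assoc J₁ (c J₁) (d J₁) ⟨
        J₁ * c J₁ * d J₁            ≤⟨ *-monoˡ-≤ (d J₁) (*-mono-≤ (n≤1+n J₁) (c≤P J₁)) ⟩
        suc J₁ * P J₁ * d J₁        ≤⟨ *-monoˡ-≤ (d J₁) (≤-trans ([2+J]*P[1+J]≤τ[1+J] J) τ[1+J]≤M) ⟩
        M * d J₁                    ∎

    E-count : J₁ * countBelow (E₀) M ≤ 7 * M
    E-count = begin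
      J₁ * countBelow E₀ M                                    ≡⟨ cong (J₁ *_) (decompose E₀) ⟩
      J₁ * (E₀-before + E₀-previous + E₀-current)             ≤⟨ *-monoʳ-≤ J₁ (+-mono-≤ (+-monoʳ-≤ E₀-before (E-split J ≤-refl))
                                                                                      (E-split J₁ m≤L)) ⟩
      J₁ * (E₀-before + (W₁ + V₁) + (W₂ + V₂))                 ≡⟨ distrib J₁ E₀-before W₁ V₁ W₂ V₂ ⟩
      J₁ * E₀-before + (J₁ * W₁ + J₁ * V₁) + (J₁ * W₂ + J₁ * V₂)
        ≤⟨ +-mono-≤ (+-mono-≤ before (+-mono-≤ window-previous interval-previous))
                    (+-mono-≤ window-current interval-current) ⟩
      M + ((M + M) + M) + ((M + M) + M)                       ≡⟨ sum-of-sevens M ⟩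
      7 * M                                                   ∎
      where
      open ≤-Reasoning
      I : ℕ → ℕ → Bool
      I K = inInterval (s K ∸ τ K) (τ K + suc K)
      E₀-before = countBelow E₀ (τ J)
      E₀-previous = countBelow (E₀ ∘ (τ J +_)) (L J)
      E₀-current = countBelow (E₀ ∘ (τ J₁ +_)) m
      W₁ = countBelow (window J) (L J)
      V₁ = countBelow (I J) (L J)
      W₂ = countBelow (window J₁) m
      V₂ = countBelow (I J₁) m
      E-split : ∀ K {n} → n ≤ L K → countBelow (E₀ ∘ (τ K +_)) n ≤ countBelow (window K) n + countBelow (I K) n
      E-split K {n} n≤L = countBelow-⊆∪ n (λ y<n → E-local (<-≤-trans y<n n≤L))
      distrib : ∀ k a b c d e → k * (a + (b + c) + (d + e)) ≡ k * a + (k * b + k * c) + (k * d + k * e)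
      distrib = solve-∀
      sum-of-sevens : ∀ M → M + ((M + M) + M) + ((M + M) + M) ≡ 7 * M
      sum-of-sevens = solve-∀
      before : J₁ * E₀-before ≤ M
      before = ≤-trans (*-monoʳ-≤ J₁ (countBelow-≤ E₀ (τ J))) J₁*τ≤M
      window-previous : J₁ * W₁ ≤ M + M
      window-previous = ≤-trans (window-count J (L J)) (+-mono-≤ L≤M (≤-trans (P≤τ[1+J] J) τ[1+J]≤M))
      interval-previous : J₁ * V₁ ≤ M
      interval-previous = ≤-trans (interval-count J (L J)) (≤-trans (≤-reflexive (τ+L≡τ[1+J] J)) τ[1+J]≤M)
      window-current : J₁ * W₂ ≤ M + M
      window-current = ≤-trans (*-monoˡ-≤ W₂ (n≤1+n J₁)) (≤-trans (window-count J₁ m)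
        (+-mono-≤ (m∸n≤m M (τ J₁)) (≤-trans (≤-trans (m≤n*m (P J₁) (suc J₁)) ([2+J]*P[1+J]≤τ[1+J] J)) τ[1+J]≤M)))
      interval-current : J₁ * V₂ ≤ M
      interval-current = ≤-trans (*-monoˡ-≤ V₂ (n≤1+n J₁)) (≤-trans (interval-count J₁ m) (≤-reflexive (m+[n∸m]≡n τ[1+J]≤M)))

    J₁*s₀≤M : J₁ * s 0 ≤ M
    J₁*s₀≤M = ≤-trans (*-mono-≤ (n≤1+n J₁) (s-mono z≤n)) (≤-trans ([2+J]*s≤τ[1+J] J) τ[1+J]≤M)

    X-close : J₁ * discrepancy (e J₁) (d J₁) (countBelow X₀ M) M ≤ 14 * (M * d J₁)
    X-close = begin
      J₁ * D CX M                                    ≤⟨ *-monoʳ-≤ J₁ (discrepancy-count-change (e J₁) (d J₁) CA CX M) ⟩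
      J₁ * (∣ CX - CA ∣ * d J₁ + D CA M)             ≡⟨ *-distribˡ-+ J₁ (∣ CX - CA ∣ * d J₁) (D CA M) ⟩
      J₁ * (∣ CX - CA ∣ * d J₁) + J₁ * D CA M        ≡⟨ cong (_+ J₁ * D CA M) (*-assoc J₁ ∣ CX - CA ∣ (d J₁)) ⟨
      J₁ * ∣ CX - CA ∣ * d J₁ + J₁ * D CA M          ≤⟨ +-mono-≤ (*-monoˡ-≤ (d J₁) J₁*∣CX-CA∣≤8M) A-close ⟩
      8 * M * d J₁ + 6 * (M * d J₁)                  ≡⟨ 8x*y+6[x*y]≡14[x*y] M (d J₁) ⟩
      14 * (M * d J₁)                                ∎
      where
      open ≤-Reasoning
      D = discrepancy (e J₁) (d J₁)
      CA = countBelow (A₀) M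
      CX = countBelow X₀ M
      CE = countBelow (E₀) M
      ∣CX-CA∣≤CE+s₀ : ∣ CX - CA ∣ ≤ CE + s 0
      ∣CX-CA∣≤CE+s₀ = ∣m-n∣≤o
        (≤-trans (countBelow-⊆∪ {X₀} {A₀} {E₀} M (λ _ → X⊆A∪E)) (+-monoʳ-≤ CA (m≤m+n CE (s 0))))
        (≤-trans (countBelow-translate {A₀} {X₀} (s 0) M (λ {y} → A+s₀⊆X {y})) (+-monoʳ-≤ CX (m≤n+m (s 0) CE)))
      J₁*∣CX-CA∣≤8M : J₁ * ∣ CX - CA ∣ ≤ 8 * M
      J₁*∣CX-CA∣≤8M = begin
        J₁ * ∣ CX - CA ∣        ≤⟨ *-monoʳ-≤ J₁ ∣CX-CA∣≤CE+s₀ ⟩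
        J₁ * (CE + s 0)         ≡⟨ *-distribˡ-+ J₁ CE (s 0) ⟩
        J₁ * CE + J₁ * s 0      ≤⟨ +-mono-≤ E-count J₁*s₀≤M ⟩
        7 * M + M               ≡⟨ +-comm (7 * M) M ⟩
        8 * M                   ∎
      8x*y+6[x*y]≡14[x*y] : ∀ x y → 8 * x * y + 6 * (x * y) ≡ 14 * (x * y)
      8x*y+6[x*y]≡14[x*y] = solve-∀

  FollowsFractions : (ℕ → Bool) → Set
  FollowsFractions f = ∀ {N J} → block N ≡ suc J →
    suc J * discrepancy (e (suc J)) (d (suc J)) (countBelow f (suc N)) (suc N) ≤ 14 * (suc N * d (suc J))

  A-follows : FollowsFractions (A₀)
  A-follows {N} {J} block-N = ≤-trans (AtPosition.A-close block-N) (*-monoˡ-≤ (suc N * d (suc J)) (m≤m+n 6 8))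

  X-follows : FollowsFractions X₀
  X-follows block-N = AtPosition.X-close block-N

module Rationals where

  open import Data.Nat.Base as ℕ using (ℕ; suc)
  import Data.Nat.Properties as ℕ
  open import Data.Nat.Tactic.RingSolver using (solve-∀)
  open import Data.Integer.Base as ℤ using (+_; _⊖_)
  import Data.Integer.Properties as ℤ
  open import Data.Rational.Base
  open import Data.Rational.Properties
  import Data.Rational.Unnormalised.Base as ℚᵘ
  import Data.Rational.Unnormalised.Properties as ℚᵘ
  open import Data.Product using (Σ; _×_; _,_; proj₁; proj₂)
  open import Data.Rational.Solver using (module +-*-Solver)
  open import Data.Sum using (inj₁; inj₂)
  open import Function using (_⇔_; mk⇔)
  import Function
  open import Relation.Binary.PropositionalEquality

  private
    toℚᵘ-/ : ∀ i n → toℚᵘ (i / suc n) ℚᵘ.≃ ℚᵘ.mkℚᵘ i n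
    toℚᵘ-/ i n = toℚᵘ-fromℚᵘ (ℚᵘ.mkℚᵘ i n)

    ∣m⊖n∣≡∣m-n∣ : ∀ m n → ℤ.∣ m ⊖ n ∣ ≡ ℕ.∣ m - n ∣
    ∣m⊖n∣≡∣m-n∣ m n with ℕ.≤-total m n
    ... | inj₁ m≤n = trans (ℤ.∣⊖∣-≤ m≤n) (sym (ℕ.m≤n⇒∣m-n∣≡n∸m m≤n))
    ... | inj₂ n≤m = trans (cong ℤ.∣_∣ (ℤ.⊖-≥ n≤m)) (sym (ℕ.m≤n⇒∣n-m∣≡n∸m n≤m))

  a/b≤c/d : ∀ a b c d → a ℕ.* suc d ℕ.≤ c ℕ.* suc b → + a / suc b ≤ + c / suc d
  a/b≤c/d a b c d ad≤cb = toℚᵘ-cancel-≤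
    (ℚᵘ.≤-respʳ-≃ (ℚᵘ.≃-sym (toℚᵘ-/ (+ c) d)) (ℚᵘ.≤-respˡ-≃ (ℚᵘ.≃-sym (toℚᵘ-/ (+ a) b))
      (ℚᵘ.*≤* (subst₂ ℤ._≤_ (ℤ.pos-* a (suc d)) (ℤ.pos-* c (suc b)) (ℤ.+≤+ ad≤cb)))))

  a/b≡c/d : ∀ a b c d → a ℕ.* suc d ≡ c ℕ.* suc b → + a / suc b ≡ + c / suc d
  a/b≡c/d a b c d ad≡cb = ≤-antisym (a/b≤c/d a b c d (ℕ.≤-reflexive ad≡cb)) (a/b≤c/d c d a b (ℕ.≤-reflexive (sym ad≡cb)))

  a/b+c/d≡[ad+cb]/bd : ∀ a b c d →
    + a / suc b + + c / suc d ≡ + (a ℕ.* suc d ℕ.+ c ℕ.* suc b) / (suc b ℕ.* suc d)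
  a/b+c/d≡[ad+cb]/bd a b c d = toℚᵘ-injective (ℚᵘ.≃-trans (toℚᵘ-homo-+ (+ a / suc b) (+ c / suc d))
    (ℚᵘ.≃-trans (ℚᵘ.+-cong (toℚᵘ-/ (+ a) b) (toℚᵘ-/ (+ c) d))
    (ℚᵘ.≃-trans (ℚᵘ.≃-reflexive (cong (λ n → ℚᵘ.mkℚᵘ n (d ℕ.+ b ℕ.* suc d)) numerator≡))
                (ℚᵘ.≃-sym (toℚᵘ-/ (+ (a ℕ.* suc d ℕ.+ c ℕ.* suc b)) (d ℕ.+ b ℕ.* suc d))))))
    where
    numerator≡ : + a ℤ.* + suc d ℤ.+ + c ℤ.* + suc b ≡ + (a ℕ.* suc d ℕ.+ c ℕ.* suc b)
    numerator≡ = sym (trans (ℤ.pos-+ (a ℕ.* suc d) _) (cong₂ ℤ._+_ (ℤ.pos-* a (suc d)) (ℤ.pos-* c (suc b))))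

  a/n+b/n≡[a+b]/n : ∀ a b n → + a / suc n + + b / suc n ≡ + (a ℕ.+ b) / suc n
  a/n+b/n≡[a+b]/n a b n = trans (a/b+c/d≡[ad+cb]/bd a n b n)
    (a/b≡c/d (a ℕ.* suc n ℕ.+ b ℕ.* suc n) (n ℕ.+ n ℕ.* suc n) (a ℕ.+ b) n (eq a b (suc n)))
    where
    eq : ∀ a b n → (a ℕ.* n ℕ.+ b ℕ.* n) ℕ.* n ≡ (a ℕ.+ b) ℕ.* (n ℕ.* n)
    eq = solve-∀

  ∣a/b-c/d∣≤u/v⇔ : ∀ a b c d u v →
    (∣ + a / suc b - + c / suc d ∣ ≤ + u / suc v) ⇔
    (suc v ℕ.* ℕ.∣ a ℕ.* suc d - c ℕ.* suc b ∣ ℕ.≤ u ℕ.* (suc b ℕ.* suc d))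
  ∣a/b-c/d∣≤u/v⇔ a b c d u v = mk⇔
    (λ le → unpack (ℚᵘ.≤-respʳ-≃ (toℚᵘ-/ (+ u) v) (ℚᵘ.≤-respˡ-≃ toℚᵘ-distance (toℚᵘ-mono-≤ le))))
    (λ le → toℚᵘ-cancel-≤ (ℚᵘ.≤-respʳ-≃ (ℚᵘ.≃-sym (toℚᵘ-/ (+ u) v))
      (ℚᵘ.≤-respˡ-≃ (ℚᵘ.≃-sym toℚᵘ-distance) (pack le))))
    where
    D = ℕ.∣ a ℕ.* suc d - c ℕ.* suc b ∣
    distanceᵘ = ℚᵘ.mkℚᵘ (+ D) (ℕ.pred (suc b ℕ.* suc d))

    numerator≡ : ℤ.∣ + a ℤ.* + suc d ℤ.+ ℤ.- (+ c) ℤ.* + suc b ∣ ≡ D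
    numerator≡ = begin
      ℤ.∣ + a ℤ.* + suc d ℤ.+ ℤ.- (+ c) ℤ.* + suc b ∣ ≡⟨ cong ℤ.∣_∣ (cong₂ ℤ._+_ (ℤ.pos-* a (suc d)) -c*b≡-[cb]) ⟨
      ℤ.∣ + (a ℕ.* suc d) ℤ.- + (c ℕ.* suc b) ∣      ≡⟨ cong ℤ.∣_∣ (ℤ.m-n≡m⊖n (a ℕ.* suc d) (c ℕ.* suc b)) ⟩
      ℤ.∣ (a ℕ.* suc d) ⊖ (c ℕ.* suc b) ∣             ≡⟨ ∣m⊖n∣≡∣m-n∣ (a ℕ.* suc d) (c ℕ.* suc b) ⟩
      D                                              ∎
      where
      open ≡-Reasoning
      -c*b≡-[cb] : ℤ.- + (c ℕ.* suc b) ≡ ℤ.- (+ c) ℤ.* + suc b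
      -c*b≡-[cb] = trans (cong ℤ.-_ (ℤ.pos-* c (suc b))) (ℤ.neg-distribˡ-* (+ c) (+ suc b))

    toℚᵘ-distance : toℚᵘ ∣ + a / suc b - + c / suc d ∣ ℚᵘ.≃ distanceᵘ
    toℚᵘ-distance = ℚᵘ.≃-trans (toℚᵘ-homo-∣-∣ (p - q)) (ℚᵘ.≃-trans (ℚᵘ.∣-∣-cong (ℚᵘ.≃-trans (toℚᵘ-homo-+ p (- q))
      (ℚᵘ.+-cong (toℚᵘ-/ (+ a) b) (ℚᵘ.≃-trans (toℚᵘ-homo‿- q) (ℚᵘ.-‿cong (toℚᵘ-/ (+ c) d))))))
      (ℚᵘ.≃-reflexive (cong (λ n → ℚᵘ.mkℚᵘ (+ n) (d ℕ.+ b ℕ.* suc d)) numerator≡)))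
      where
      p = + a / suc b
      q = + c / suc d

    unpack : distanceᵘ ℚᵘ.≤ ℚᵘ.mkℚᵘ (+ u) v → suc v ℕ.* D ℕ.≤ u ℕ.* (suc b ℕ.* suc d)
    unpack (ℚᵘ.*≤* le) = subst₂ ℕ._≤_ (ℕ.*-comm D (suc v)) refl
      (ℤ.drop‿+≤+ (subst₂ ℤ._≤_ (sym (ℤ.pos-* D (suc v))) (sym (ℤ.pos-* u (suc b ℕ.* suc d))) le))

    pack : suc v ℕ.* D ℕ.≤ u ℕ.* (suc b ℕ.* suc d) → distanceᵘ ℚᵘ.≤ ℚᵘ.mkℚᵘ (+ u) v
    pack le = ℚᵘ.*≤* (subst₂ ℤ._≤_ (ℤ.pos-* D (suc v)) (ℤ.pos-* u (suc b ℕ.* suc d))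
      (ℤ.+≤+ (subst₂ ℕ._≤_ (ℕ.*-comm (suc v) D) refl le)))

  p-q≤r⇔p≤q+r : ∀ p q r → (p - q ≤ r) ⇔ (p ≤ q + r)
  p-q≤r⇔p≤q+r p q r = mk⇔
    (λ p-q≤r → subst₂ _≤_ (p-q+q≡p p q) (+-comm r q) (+-monoˡ-≤ q p-q≤r))
    (λ p≤q+r → subst (p - q ≤_) (q+r-q≡r q r) (+-monoˡ-≤ (- q) p≤q+r))
    where
    open +-*-Solver
    p-q+q≡p : ∀ p q → p - q + q ≡ p
    p-q+q≡p = solve 2 (λ p q → p :- q :+ q := p) refl
    q+r-q≡r : ∀ q r → q + r - q ≡ r
    q+r-q≡r = solve 2 (λ q r → q :+ r :- q := r) refl

  -[p-q]≡q-p : ∀ p q → - (p - q) ≡ q - p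
  -[p-q]≡q-p = solve 2 (λ p q → :- (p :- q) := q :- p) refl
    where open +-*-Solver

  p≤∣p∣ : ∀ p → p ≤ ∣ p ∣
  p≤∣p∣ p with ≤-total 0ℚ p
  ... | inj₁ 0≤p = ≤-reflexive (sym (0≤p⇒∣p∣≡p 0≤p))
  ... | inj₂ p≤0 = ≤-trans p≤0 (0≤∣p∣ p)

  ∣p-q∣≡∣q-p∣ : ∀ p q → ∣ p - q ∣ ≡ ∣ q - p ∣
  ∣p-q∣≡∣q-p∣ p q = trans (sym (∣-p∣≡∣p∣ (p - q))) (cong ∣_∣ (-[p-q]≡q-p p q))

  ∣p-q∣≤r⇔ : ∀ p q r → (∣ p - q ∣ ≤ r) ⇔ (p ≤ q + r × q ≤ p + r)
  ∣p-q∣≤r⇔ p q r = mk⇔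
    (λ ∣p-q∣≤r → to (p-q≤r⇔p≤q+r p q r) (≤-trans (p≤∣p∣ (p - q)) ∣p-q∣≤r)
               , to (p-q≤r⇔p≤q+r q p r) (≤-trans (p≤∣p∣ (q - p)) (subst (_≤ r) (∣p-q∣≡∣q-p∣ p q) ∣p-q∣≤r)))
    (λ (p≤q+r , q≤p+r) → case-abs (from (p-q≤r⇔p≤q+r p q r) p≤q+r)
               (subst (_≤ r) (sym (-[p-q]≡q-p p q)) (from (p-q≤r⇔p≤q+r q p r) q≤p+r)))
    where
    open Function.Equivalence
    case-abs : p - q ≤ r → - (p - q) ≤ r → ∣ p - q ∣ ≤ r
    case-abs h₊ h₋ with ∣p∣≡p∨∣p∣≡-p (p - q)
    ... | inj₁ ∣x∣≡x  = subst (_≤ r) (sym ∣x∣≡x) h₊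
    ... | inj₂ ∣x∣≡-x = subst (_≤ r) (sym ∣x∣≡-x) h₋

  ∣p-r∣≤∣p-q∣+∣q-r∣ : ∀ p q r → ∣ p - r ∣ ≤ ∣ p - q ∣ + ∣ q - r ∣
  ∣p-r∣≤∣p-q∣+∣q-r∣ p q r = subst (λ x → ∣ x ∣ ≤ ∣ p - q ∣ + ∣ q - r ∣) (split p q r) (∣p+q∣≤∣p∣+∣q∣ (p - q) (q - r))
    where
    open +-*-Solver
    split : ∀ p q r → (p - q) + (q - r) ≡ p - r
    split = solve 3 (λ p q r → (p :- q) :+ (q :- r) := p :- r) refl

  clamp : ℚ → ℚ
  clamp x = 0ℚ ⊔ (x ⊓ 1ℚ)

  clamp-nonNegative : ∀ x → 0ℚ ≤ clamp x
  clamp-nonNegative x = p≤p⊔q 0ℚ (x ⊓ 1ℚ)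

  clamp≤1 : ∀ x → clamp x ≤ 1ℚ
  clamp≤1 x = ⊔-lub (nonNegative⁻¹ 1ℚ) (p⊓q≤q x 1ℚ)

  clamp-close : ∀ {x y u w} → ∣ x - y ∣ ≤ w → - u ≤ y → y ≤ 1ℚ + u → u ≤ w → ∣ clamp x - y ∣ ≤ w
  clamp-close {x} {y} {u} {w} ∣x-y∣≤w -u≤y y≤1+u u≤w = from (∣p-q∣≤r⇔ (clamp x) y w) (clamp≤y+w , y≤clamp+w)
    where
    open Function.Equivalence
    x≤y+w = proj₁ (to (∣p-q∣≤r⇔ x y w) ∣x-y∣≤w)
    y≤x+w = proj₂ (to (∣p-q∣≤r⇔ x y w) ∣x-y∣≤w)
    clamp≤y+w : clamp x ≤ y + w
    clamp≤y+w = ⊔-lub (subst (_≤ y + w) (+-inverseˡ u) (+-mono-≤ -u≤y u≤w)) (≤-trans (p⊓q≤p x 1ℚ) x≤y+w)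
    y≤clamp+w : y ≤ clamp x + w
    y≤clamp+w = ≤-trans
      (subst (y ≤_) (sym (mono-≤-distrib-⊓ (+-monoˡ-≤ w) x 1ℚ)) (⊓-glb y≤x+w (≤-trans y≤1+u (+-monoʳ-≤ 1ℚ u≤w))))
      (+-monoˡ-≤ w (p≤q⊔p 0ℚ (x ⊓ 1ℚ)))

  unit-interval-fraction : ∀ p → 0ℚ ≤ p → p ≤ 1ℚ → Σ ℕ λ n → Σ ℕ λ d → n ℕ.≤ suc d × p ≡ + n / suc d
  unit-interval-fraction p@(mkℚ (+ n) d _) _ p≤1 = n , d , n≤1+d , sym (↥p/↧p≡p p)
    where
    n≤1+d = ℤ.drop‿+≤+ (subst₂ ℤ._≤_ (ℤ.*-identityʳ (+ n)) (ℤ.*-identityˡ (+ suc d)) (drop-*≤* p≤1))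
  unit-interval-fraction (mkℚ ℤ.-[1+ _ ] _ _) (*≤* ()) _

  within-triangle : ∀ {δ ε p q x} → ∣ p - q ∣ ≤ δ → within ε q x → within (δ + ε) p x
  within-triangle {δ} {ε} {p} {q} {x} ∣p-q∣≤δ q≈x j = begin
    ∣ p - seq x j ∣                     ≤⟨ ∣p-r∣≤∣p-q∣+∣q-r∣ p q (seq x j) ⟩
    ∣ p - q ∣ + ∣ q - seq x j ∣         ≤⟨ +-mono-≤ ∣p-q∣≤δ (q≈x j) ⟩
    δ + (ε + + 1 / suc j)               ≡⟨ +-assoc δ ε (+ 1 / suc j) ⟨
    δ + ε + + 1 / suc j                 ∎
    where open ≤-Reasoning

  within-weaken : ∀ {ε ε′ q x} → ε ≤ ε′ → within ε q x → within ε′ q x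
  within-weaken {ε} {ε′} ε≤ε′ q≈x j = ≤-trans (q≈x j) (+-monoˡ-≤ (+ 1 / suc j) ε≤ε′)

  1/[2+n]≤1/[1+n] : ∀ n → + 1 / suc (suc n) ≤ + 1 / suc n
  1/[2+n]≤1/[1+n] n = a/b≤c/d 1 (suc n) 1 n (ℕ.*-monoʳ-≤ 1 (ℕ.n≤1+n (suc n)))

module Approximation (α : ℝ) (0<α : 0<ℝ α) (α<1 : ℝ<1 α) where

  open import Data.Nat.Base as ℕ using (ℕ; suc)
  open import Data.Integer.Base using (+_)
  open import Data.Rational.Base
  open import Data.Rational.Properties
  open import Data.Rational.Solver using (module +-*-Solver)
  open import Data.Product using (Σ; _×_; proj₁; proj₂)
  open import Function using (module Equivalence)
  open import Relation.Binary.PropositionalEquality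
  open Rationals

  private
    open Function.Equivalence
    open +-*-Solver

    ⅟ : ℕ → ℚ
    ⅟ n = + 1 / suc n

    α≤α+ : ∀ m n → seq α m ≤ seq α n + (⅟ m + ⅟ n)
    α≤α+ m n = proj₁ (to (∣p-q∣≤r⇔ (seq α m) (seq α n) _) (reg α m n))

  -1/[1+i]≤α : ∀ i → - (+ 1 / suc i) ≤ seq α i
  -1/[1+i]≤α i = subst₂ _≤_ (a-[a+b]≡-b (⅟ n) (⅟ i)) (x+[a+b]-[a+b]≡x (seq α i) (⅟ n + ⅟ i))
    (+-monoˡ-≤ (- (⅟ n + ⅟ i)) (≤-trans (<⇒≤ (proj₂ 0<α)) (α≤α+ n i)))
    where
    n = proj₁ 0<α
    a-[a+b]≡-b : ∀ a b → a - (a + b) ≡ - b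
    a-[a+b]≡-b = solve 2 (λ a b → a :- (a :+ b) := :- b) refl
    x+[a+b]-[a+b]≡x : ∀ x c → x + c - c ≡ x
    x+[a+b]-[a+b]≡x = solve 2 (λ x c → x :+ c :- c := x) refl

  α≤1+1/[1+i] : ∀ i → seq α i ≤ 1ℚ + + 1 / suc i
  α≤1+1/[1+i] i = ≤-trans (α≤α+ i n) (subst (seq α n + (⅟ i + ⅟ n) ≤_) (1-b+[a+b]≡1+a (⅟ i) (⅟ n))
    (+-monoˡ-≤ (⅟ i + ⅟ n) (<⇒≤ (proj₂ α<1))))
    where
    n = proj₁ α<1
    1-b+[a+b]≡1+a : ∀ a b → 1ℚ - b + (a + b) ≡ 1ℚ + a
    1-b+[a+b]≡1+a = solve 2 (λ a b → con 1ℚ :- b :+ (a :+ b) := con 1ℚ :+ a) refl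

  approximant : ℕ → ℚ
  approximant J = clamp (seq α J)

  approximant-within : ∀ J → within (+ 1 / suc J) (approximant J) α
  approximant-within J i = clamp-close {seq α J} (reg α J i) (-1/[1+i]≤α i) (α≤1+1/[1+i] i)
    (subst (_≤ ⅟ J + ⅟ i) (+-identityˡ (⅟ i)) (+-monoˡ-≤ (⅟ i) (a/b≤c/d 0 0 1 J ℕ.z≤n)))

  private
    fraction : ∀ J → Σ ℕ λ n → Σ ℕ λ d → n ℕ.≤ suc d × approximant J ≡ + n / suc d
    fraction J = unit-interval-fraction (approximant J) (clamp-nonNegative (seq α J)) (clamp≤1 (seq α J))

  num den-1 : ℕ → ℕ
  num J = proj₁ (fraction J)
  den-1 J = proj₁ (proj₂ (fraction J))

  fraction-within : ∀ J → within (+ 1 / suc J) (+ num J / suc (den-1 J)) α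
  fraction-within J = subst (λ q → within (+ 1 / suc J) q α) (proj₂ (proj₂ (proj₂ (fraction J)))) (approximant-within J)

  -- Both fractions are close to the term of α at index J + 1.
  fractions-close : ∀ J → ∣ + num J / suc (den-1 J) - + num (suc J) / suc (den-1 (suc J)) ∣ ≤ + 4 / suc J
  fractions-close J = begin
    ∣ q₀ - q₁ ∣                                 ≤⟨ ∣p-r∣≤∣p-q∣+∣q-r∣ q₀ a q₁ ⟩
    ∣ q₀ - a ∣ + ∣ a - q₁ ∣                      ≡⟨ cong (λ x → ∣ q₀ - a ∣ + x) (∣p-q∣≡∣q-p∣ a q₁) ⟩
    ∣ q₀ - a ∣ + ∣ q₁ - a ∣                      ≤⟨ +-mono-≤ (fraction-within J (suc J)) (fraction-within (suc J) (suc J)) ⟩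
    (⅟ J + ⅟ (suc J)) + (⅟ (suc J) + ⅟ (suc J))   ≤⟨ +-mono-≤ (+-monoʳ-≤ (⅟ J) 1/[1+J]≤) (+-mono-≤ 1/[1+J]≤ 1/[1+J]≤) ⟩
    (⅟ J + ⅟ J) + (⅟ J + ⅟ J)               ≡⟨ cong₂ _+_ (a/n+b/n≡[a+b]/n 1 1 J) (a/n+b/n≡[a+b]/n 1 1 J) ⟩
    + 2 / suc J + + 2 / suc J                   ≡⟨ a/n+b/n≡[a+b]/n 2 2 J ⟩
    + 4 / suc J                                 ∎
    where
    open ≤-Reasoning
    q₀ = + num J / suc (den-1 J)
    q₁ = + num (suc J) / suc (den-1 (suc J))
    a = seq α (suc J)
    1/[1+J]≤ = 1/[2+n]≤1/[1+n] J

  slowly-varying-fractions : SlowlyVaryingFractions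
  slowly-varying-fractions = record
    { num = num
    ; den-1 = den-1
    ; num≤den = λ J → proj₁ (proj₂ (proj₂ (fraction J)))
    ; slowly-varying = λ J → to (∣a/b-c/d∣≤u/v⇔ (num J) (den-1 J) (num (suc J)) (den-1 (suc J)) 4 J) (fractions-close J)
    }

module Density (α : ℝ) (0<α : 0<ℝ α) (α<1 : ℝ<1 α) where

  open import Data.Nat.Base as ℕ using (suc)
  import Data.Nat.Properties as ℕ
  open import Data.Integer.Base using (+_)
  open import Data.Rational.Base using (_/_; _≤_; _+_; _-_; ∣_∣)
  open import Data.Rational.Properties using (+-monoʳ-≤)
  open import Data.Product using (_,_)
  open import Function using (_∘_; module Equivalence)
  open import Relation.Binary.PropositionalEquality using (refl; subst; sym)
  open Counting using (count≡countBelow; discrepancy)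
  open Rationals

  open Approximation α 0<α α<1 public using (num; den-1; slowly-varying-fractions; fraction-within)
  open Construction slowly-varying-fractions public

  15/[1+J]≤1/[1+k] : ∀ {k J} → 15 ℕ.* suc k ℕ.≤ suc J → + 14 / suc J + + 1 / suc (suc J) ≤ + 1 / suc k
  15/[1+J]≤1/[1+k] {k} {J} 15[1+k]≤1+J = begin
    + 14 / suc J + + 1 / suc (suc J)  ≤⟨ +-monoʳ-≤ (+ 14 / suc J) (1/[2+n]≤1/[1+n] J) ⟩
    + 14 / suc J + + 1 / suc J        ≡⟨ a/n+b/n≡[a+b]/n 14 1 J ⟩
    + 15 / suc J                      ≤⟨ a/b≤c/d 15 J 1 k (subst (15 ℕ.* suc k ℕ.≤_) (sym (ℕ.*-identityˡ (suc J))) 15[1+k]≤1+J) ⟩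
    + 1 / suc k                       ∎
    where open Data.Rational.Properties.≤-Reasoning

  density : ∀ C → FollowsFractions (C ∘ suc) → HasDensity C α
  density C follows k = τ (15 ℕ.* suc k) , λ N τ≤N → at N (block N) refl (block-≥ τ≤N)
    where
    at : ∀ N J → block N ≡ J → 15 ℕ.* suc k ℕ.≤ J → within (+ 1 / suc k) (+ count C (suc N) / suc N) α
    at N (suc J) block-N 15[1+k]≤1+J =
      within-weaken {ε} {+ 1 / suc k} {C/M} {α} (15/[1+J]≤1/[1+k] 15[1+k]≤1+J)
        (within-triangle {+ 14 / suc J} {+ 1 / suc (suc J)} {C/M} {e/d} {α} C/M≈e/d (fraction-within (suc J)))
      where
      C/M = + count C (suc N) / suc N
      e/d = + num (suc J) / suc (den-1 (suc J))
      ε = + 14 / suc J + + 1 / suc (suc J)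
      C/M≈e/d : ∣ C/M - e/d ∣ ≤ + 14 / suc J
      C/M≈e/d = Equivalence.from (∣a/b-c/d∣≤u/v⇔ (count C (suc N)) N (num (suc J)) (den-1 (suc J)) 14 J)
        (subst (λ n → suc J ℕ.* discrepancy (num (suc J)) (d (suc J)) n (suc N) ℕ.≤ 14 ℕ.* (suc N ℕ.* d (suc J)))
               (sym (count≡countBelow C (suc N))) (follows block-N))

proposition15p1 : (α : ℝ) → 0<ℝ α → ℝ<1 α →
    Σ Subset λ A → Σ Subset λ B →
      (A 0 ≡ false) × (B 0 ≡ false) ×
      HasDensity A α × MeetsEveryResidueClass B × HasDensity (A ⊕ B) α
proposition15p1 α 0<α α<1 =
  A , B , refl , B-zero , density A A-follows , B-meets-residue-classes , density (A ⊕ B) X-follows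
  where open Density α 0<α α<1
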